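{- Let $A\in\mathsf{Form}_{\mathbf{C}}$. If $A$ is 3-valid, then $\sigma(A)$ is 3-valid for every uniform substitution $\sigma:\mathsf{Prop}\to\mathsf{Form}$.
   Context: $\mathsf{Form}$ is the set of formulas built from a countably infinite set $\mathsf{Prop}$ of propositional variables by $A ::= p \mid \bot \mid A \lor A \mid A \land A \mid A \to_{\mathtt{i}} A \mid A \to_{\mathtt{c}} A$; $\mathsf{Form}_{\mathbf{C}}$ is the set of formulas not containing $\to_{\mathtt{i}}$. A uniform substitution $\sigma:\mathsf{Prop}\to\mathsf{Form}$ is extended to formulas by replacing each variable $p$ by $\sigma(p)$ and commuting with all connectives. A three-valued valuation $v:\mathsf{Prop}\to\{\{0\},\{0,1\},\{1\}\}$ extends uniquely to $\overline{v}$ on all formulas by: $\overline v(p)=v(p)$; $1\notin\overline v(\bot)$, $0\in\overline v(\bot)$; $1\in\overline v(A\land B)$ iff $1\in\overline v(A)$ and $1\in \overline v(B)$; $0\in\overline v(A\land B)$ iff $0\in\overline v(A)$ or $0\in\overline v(B)$; $1\in\overline v(A\lor B)$ iff $1\in\overline v(A)$ or $1\in\overline v(B)$; $0\in\overline v(A\lor B)$ iff $0\in\overline v(A)$ and $0\in\overline v(B)$; $1\in\overline v(A\to_{\mathtt{c}}B)$ iff $0\in\overline v(A)$ or $1\in\overline v(B)$; $0\in\overline v(A\to_{\mathtt{c}}B)$ iff $1\in\overline v(A)$ and $0\in\overline v(B)$; $1\in\overline v(A\to_{\mathtt{i}}B)$ iff $1\notin\overline v(A)$ or $1\in\overline v(B)$;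 $0\in\overline v(A\to_{\mathtt{i}}B)$ iff $1\in\overline v(A)$ and $0\in\overline v(B)$. A formula $A$ is 3-valid if $1\in\overline v(A)$ for every three-valued valuation $v$. -}

module Defs where

open import Data.Nat using (ℕ)
open import Data.Bool using (Bool; true; false; _∧_; _∨_; not)
open import Relation.Binary.PropositionalEquality using (_≡_)

Prop : Set
Prop = ℕ

data Form : Set where
  var  : Prop → Form
  ⊥'   : Form
  _∨'_ : Form → Form → Form
  _∧'_ : Form → Form → Form
  _→i_ : Form → Form → Form
  _→c_ : Form → Form → Form

-- A formula lies in Form_C iff it contains no →i.
data IsC : Form → Set where
  var : ∀ p → IsC (var p)
  ⊥'  : IsC ⊥'
  _∨'_ : ∀ {A B} → IsC A → IsC B → IsC (A ∨' B)
  _∧'_ : ∀ {A B} → IsC A → IsC B → IsC (A ∧' B)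
  _→c_ : ∀ {A B} → IsC A → IsC B → IsC (A →c B)

Subst : Set
Subst = Prop → Form

subst : Subst → Form → Form
subst σ (var p)  = σ p
subst σ ⊥'       = ⊥'
subst σ (A ∨' B) = subst σ A ∨' subst σ B
subst σ (A ∧' B) = subst σ A ∧' subst σ B
subst σ (A →i B) = subst σ A →i subst σ B
subst σ (A →c B) = subst σ A →c subst σ B

-- The three values {0}, {0,1}, {1}.
data V3 : Set where
  v0 v01 v1 : V3

has0 : V3 → Bool
has0 v0  = true
has0 v01 = true
has0 v1  = false

has1 : V3 → Bool
has1 v0  = false
has1 v01 = true
has1 v1  = true

Valuation : Set
Valuation = Prop → V3

-- Extension of a valuation: (0 ∈ v̄ A , 1 ∈ v̄ A) computed simultaneously.
record Val : Set where
  constructor ⟨_,_⟩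
  field
    zero∈ : Bool
    one∈  : Bool
open Val public

ext : Valuation → Form → Val
ext v (var p)  = ⟨ has0 (v p) , has1 (v p) ⟩
ext v ⊥'       = ⟨ true , false ⟩
ext v (A ∧' B) = ⟨ zero∈ (ext v A) ∨ zero∈ (ext v B) , one∈ (ext v A) ∧ one∈ (ext v B) ⟩
ext v (A ∨' B) = ⟨ zero∈ (ext v A) ∧ zero∈ (ext v B) , one∈ (ext v A) ∨ one∈ (ext v B) ⟩
ext v (A →c B) = ⟨ one∈ (ext v A) ∧ zero∈ (ext v B) , zero∈ (ext v A) ∨ one∈ (ext v B) ⟩
ext v (A →i B) = ⟨ one∈ (ext v A) ∧ zero∈ (ext v B) , not (one∈ (ext v A)) ∨ one∈ (ext v B) ⟩

3-valid : Form → Set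
3-valid A = ∀ (v : Valuation) → one∈ (ext v A) ≡ true

{-# OPTIONS --safe #-}
-- Under any valuation w, the value of every formula is non-empty, so p ↦ w̄(σ p)
-- is itself a three-valued valuation w′. Every connective, →i included, computes
-- the value of a compound from the values of its parts, hence w̄(σ A) = w̄′(A) and
-- validity of A gives validity of σ A.
module Submission where

open import Defs
open import Data.Bool using (true; false; _∧_; _∨_; not; T)
open import Data.Unit using (tt)
open import Relation.Binary.PropositionalEquality using (_≡_; refl; sym; trans; cong)

Nonempty : Val → Set
Nonempty x = T (zero∈ x ∨ one∈ x)

∧-nonempty : ∀ a b → Nonempty a → Nonempty b →
             Nonempty ⟨ zero∈ a ∨ zero∈ b , one∈ a ∧ one∈ b ⟩
∧-nonempty ⟨ true  , _    ⟩ _         _ _  = tt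
∧-nonempty ⟨ false , true ⟩ ⟨ _ , _ ⟩ _ nb = nb

∨-nonempty : ∀ a b → Nonempty a → Nonempty b →
             Nonempty ⟨ zero∈ a ∧ zero∈ b , one∈ a ∨ one∈ b ⟩
∨-nonempty ⟨ true  , true  ⟩ ⟨ true  , _ ⟩ _ _  = tt
∨-nonempty ⟨ true  , true  ⟩ ⟨ false , _ ⟩ _ _  = tt
∨-nonempty ⟨ false , true  ⟩ _             _ _  = tt
∨-nonempty ⟨ true  , false ⟩ ⟨ _ , _ ⟩     _ nb = nb

→c-nonempty : ∀ a b → Nonempty a → Nonempty b →
              Nonempty ⟨ one∈ a ∧ zero∈ b , zero∈ a ∨ one∈ b ⟩
→c-nonempty ⟨ true  , false ⟩ _             _ _  = tt
→c-nonempty ⟨ true  , true  ⟩ ⟨ true  , _ ⟩ _ _  = tt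
→c-nonempty ⟨ true  , true  ⟩ ⟨ false , _ ⟩ _ _  = tt
→c-nonempty ⟨ false , true  ⟩ ⟨ _ , _ ⟩     _ nb = nb

→i-nonempty : ∀ a b → Nonempty b →
              Nonempty ⟨ one∈ a ∧ zero∈ b , not (one∈ a) ∨ one∈ b ⟩
→i-nonempty ⟨ _ , false ⟩ _         _  = tt
→i-nonempty ⟨ _ , true  ⟩ ⟨ _ , _ ⟩ nb = nb

ext-nonempty : ∀ v A → Nonempty (ext v A)
ext-nonempty v (var p) with v p
... | v0  = tt
... | v01 = tt
... | v1  = tt
ext-nonempty v ⊥'       = tt
ext-nonempty v (A ∨' B) = ∨-nonempty (ext v A) (ext v B) (ext-nonempty v A) (ext-nonempty v B)
ext-nonempty v (A ∧' B) = ∧-nonempty (ext v A) (ext v B) (ext-nonempty v A) (ext-nonempty v B)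
ext-nonempty v (A →i B) = →i-nonempty (ext v A) (ext v B) (ext-nonempty v B)
ext-nonempty v (A →c B) = →c-nonempty (ext v A) (ext v B) (ext-nonempty v A) (ext-nonempty v B)

-- The empty value is sent to v0 arbitrarily; it never arises (ext-nonempty).
toV3 : Val → V3
toV3 ⟨ true  , true  ⟩ = v01
toV3 ⟨ true  , false ⟩ = v0
toV3 ⟨ false , true  ⟩ = v1
toV3 ⟨ false , false ⟩ = v0

fromV3 : V3 → Val
fromV3 x = ⟨ has0 x , has1 x ⟩

fromV3-toV3 : ∀ x → Nonempty x → fromV3 (toV3 x) ≡ x
fromV3-toV3 ⟨ true  , true  ⟩ _ = refl
fromV3-toV3 ⟨ true  , false ⟩ _ = refl
fromV3-toV3 ⟨ false , true  ⟩ _ = refl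

substValuation : Valuation → Subst → Valuation
substValuation w σ p = toV3 (ext w (σ p))

ext-subst : ∀ w σ A → ext w (subst σ A) ≡ ext (substValuation w σ) A
ext-subst w σ (var p)  = sym (fromV3-toV3 (ext w (σ p)) (ext-nonempty w (σ p)))
ext-subst w σ ⊥'       = refl
ext-subst w σ (A ∨' B) rewrite ext-subst w σ A | ext-subst w σ B = refl
ext-subst w σ (A ∧' B) rewrite ext-subst w σ A | ext-subst w σ B = refl
ext-subst w σ (A →i B) rewrite ext-subst w σ A | ext-subst w σ B = refl
ext-subst w σ (A →c B) rewrite ext-subst w σ A | ext-subst w σ B = refl

lemma11 : ∀ (A : Form) → IsC A → 3-valid A → ∀ (σ : Subst) → 3-valid (subst σ A)
lemma11 A _ valid σ w = trans (cong one∈ (ext-subst w σ A)) (valid (substValuation w σ))
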